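{- Let $q$ be a complex number with $q\neq 0,1$ and let $m,r,x$ be complex numbers. For every non-negative integer $n$, the $(q,r)$-Dowling polynomials satisfy $$D_{m,r,q}(n,x)=\sum_{k=0}^n\binom{n}{k}r^{n-k}\sum_{j=0}^k m^{k-j}\,S_q(k,j)\,x^j.$$
   Context: $[\ell]_q=\frac{q^\ell-1}{q-1}$. The $(q,r)$-Whitney numbers of the second kind $W_{m,r,q}(n,k)$ are defined by $(ma^\dagger a+r)^n=\sum_{k=0}^{n}m^kW_{m,r,q}(n,k)(a^\dagger)^k a^k$ with $q$-boson operators $aa^\dagger-qa^\dagger a=1$; equivalently $W_{m,r,q}(0,0)=1$, $W_{m,r,q}(n,k)=0$ for $k<0$ or $k>n$, and $W_{m,r,q}(n+1,k)=q^{k-1}W_{m,r,q}(n,k-1)+(m[k]_q+r)W_{m,r,q}(n,k)$. The $(q,r)$-Dowling polynomials are $D_{m,r,q}(n,x)=\sum_{k=0}^nW_{m,r,q}(n,k)x^k$. The $q$-Stirling numbers of the second kind $S_q(n,k)$ are defined by $[x]_q^n=\sum_{k=0}^n S_q(n,k)[x]_q[x-1]_q\cdots[x-k+1]_q$; equivalently $S_q(n,k)=W_{1,0,q}(n,k)$, i.e. $S_q(0,0)=1$, $S_q(n,k)=0$ for $k<0$ or $k>n$, and $S_q(n+1,k)=q^{k-1}S_q(n,k-1)+[k]_qS_q(n,k)$. -}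

module Defs where

open import Level using (Level)
open import Data.Nat using (ℕ; zero; suc)
open import Algebra.Bundles using (CommutativeRing)

module QDefs {c ℓ : Level} (R : CommutativeRing c ℓ) where
  open CommutativeRing R hiding (zero)

  fromℕ : ℕ → Carrier
  fromℕ zero    = 0#
  fromℕ (suc n) = 1# + fromℕ n

  pow : Carrier → ℕ → Carrier
  pow a zero    = 1#
  pow a (suc n) = a * pow a n

  sumTo : ℕ → (ℕ → Carrier) → Carrier
  sumTo zero    f = f zero
  sumTo (suc n) f = sumTo n f + f (suc n)

  -- q-integer [ℓ]_q = 1 + q + ... + q^(ℓ-1)  (= (q^ℓ - 1)/(q - 1) for q ≠ 1)
  qint : Carrier → ℕ → Carrier
  qint q zero    = 0#
  qint q (suc n) = qint q n + pow q n

  -- (q,r)-Whitney numbers of the second kind W_{m,r,q}(n,k), via the recurrence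
  -- W(n+1,k) = q^(k-1) W(n,k-1) + (m[k]_q + r) W(n,k), W(0,0)=1, W(n,-1)=0.
  W : (m r q : Carrier) → ℕ → ℕ → Carrier
  W m r q zero    zero    = 1#
  W m r q zero    (suc k) = 0#
  W m r q (suc n) zero    = (m * qint q zero + r) * W m r q n zero
  W m r q (suc n) (suc k) =
    pow q k * W m r q n k + (m * qint q (suc k) + r) * W m r q n (suc k)

  Sq : (q : Carrier) → ℕ → ℕ → Carrier
  Sq q = W 1# 0# q

  D : (m r q : Carrier) → ℕ → Carrier → Carrier
  D m r q n x = sumTo n (λ k → W m r q n k * pow x k)

module Submission where

-- The expansion is a binomial-shift identity for Dowling polynomials,
--   D_{m,r+s,q}(n,x) = Σ_i C(n,i) s^{n-i} D_{m,r,q}(i,x),              (★)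
-- specialised to r = 0, followed by the scaling law
--   W_{m,0,q}(n,k) = m^{n-k} S_q(n,k).

open import Defs
open import Level using (Level)
open import Data.Nat using (ℕ; _∸_)
open import Data.Nat.Combinatorics using (_C_)
open import Algebra.Bundles using (CommutativeRing)
open import Relation.Nullary using (¬_)

open import Data.Nat using (zero; suc; _≤_; _<_; _≤′_; ≤′-refl; ≤′-step; s≤s; _<?_) renaming (_+_ to _+ℕ_)
open import Data.Nat.Properties using (m≤n⇒m≤1+n; ≤-refl; ≤⇒≤′; ≤′⇒≤; n<1+n; +-∸-assoc; ≮⇒≥)
open import Data.Nat.Combinatorics using (nCk+nC[k+1]≡[n+1]C[k+1]; k>n⇒nCk≡0)
open import Relation.Nullary using (yes; no)
open import Relation.Binary.PropositionalEquality using (cong)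

module Dowling {c ℓ : Level} (R : CommutativeRing c ℓ) where
  open CommutativeRing R hiding (zero)
  open QDefs R
  open import Relation.Binary.Reasoning.Setoid setoid
  open import Algebra.Solver.Ring.NaturalCoefficients.Default commutativeSemiring

  fromℕ-+ : ∀ a b → fromℕ (a +ℕ b) ≈ fromℕ a + fromℕ b
  fromℕ-+ zero    b = sym (+-identityˡ _)
  fromℕ-+ (suc a) b = trans (+-congˡ (fromℕ-+ a b)) (sym (+-assoc _ _ _))

  sum-cong : ∀ n {f g : ℕ → Carrier} → (∀ i → i ≤ n → f i ≈ g i) → sumTo n f ≈ sumTo n g
  sum-cong zero    f≈g = f≈g 0 ≤-refl
  sum-cong (suc n) f≈g = +-cong (sum-cong n (λ i i≤n → f≈g i (m≤n⇒m≤1+n i≤n))) (f≈g (suc n) ≤-refl)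

  sum-+ : ∀ n f g → sumTo n (λ i → f i + g i) ≈ sumTo n f + sumTo n g
  sum-+ zero    f g = refl
  sum-+ (suc n) f g = begin
    sumTo n (λ i → f i + g i) + (f (suc n) + g (suc n))
      ≈⟨ +-congʳ (sum-+ n f g) ⟩
    (sumTo n f + sumTo n g) + (f (suc n) + g (suc n))
      ≈⟨ solve 4 (λ a b c d → (a :+ b) :+ (c :+ d) := (a :+ c) :+ (b :+ d)) refl _ _ _ _ ⟩
    (sumTo n f + f (suc n)) + (sumTo n g + g (suc n)) ∎

  sum-*ˡ : ∀ n a f → sumTo n (λ i → a * f i) ≈ a * sumTo n f
  sum-*ˡ zero    a f = refl
  sum-*ˡ (suc n) a f = trans (+-congʳ (sum-*ˡ n a f)) (sym (distribˡ a _ _))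

  sum-0 : ∀ n → sumTo n (λ _ → 0#) ≈ 0#
  sum-0 zero    = refl
  sum-0 (suc n) = trans (+-congʳ (sum-0 n)) (+-identityˡ 0#)

  sum-shift : ∀ n f → sumTo (suc n) f ≈ f 0 + sumTo n (λ i → f (suc i))
  sum-shift zero    f = refl
  sum-shift (suc n) f = trans (+-congʳ (sum-shift n f)) (+-assoc _ _ _)

  sum-swap : ∀ n p (f : ℕ → ℕ → Carrier) →
             sumTo n (λ k → sumTo p (f k)) ≈ sumTo p (λ i → sumTo n (λ k → f k i))
  sum-swap zero    p f = refl
  sum-swap (suc n) p f =
    trans (+-congʳ (sum-swap n p f)) (sym (sum-+ p (λ i → sumTo n (λ k → f k i)) (f (suc n))))

  sum-truncate : ∀ {i n} f → i ≤′ n → (∀ k → i < k → f k ≈ 0#) → sumTo n f ≈ sumTo i f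
  sum-truncate f ≤′-refl          vanish = refl
  sum-truncate {i} f (≤′-step {n} i≤n) vanish = begin
    sumTo n f + f (suc n)  ≈⟨ +-cong (sum-truncate f i≤n vanish) (vanish (suc n) (s≤s (≤′⇒≤ i≤n))) ⟩
    sumTo i f + 0#         ≈⟨ +-identityʳ _ ⟩
    sumTo i f              ∎

  binom : Carrier → (ℕ → Carrier) → ℕ → Carrier
  binom s F n = sumTo n (λ i → fromℕ (n C i) * pow s (n ∸ i) * F i)

  binom-cong : ∀ s n {F G : ℕ → Carrier} → (∀ i → i ≤ n → F i ≈ G i) → binom s F n ≈ binom s G n
  binom-cong s n F≈G = sum-cong n (λ i i≤n → *-congˡ (F≈G i i≤n))

  binom-+ : ∀ s n F G → binom s (λ i → F i + G i) n ≈ binom s F n + binom s G n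
  binom-+ s n F G = trans (sum-cong n (λ i _ → distribˡ _ (F i) (G i))) (sum-+ n _ _)

  binom-*ˡ : ∀ s n a F → binom s (λ i → a * F i) n ≈ a * binom s F n
  binom-*ˡ s n a F = trans (sum-cong n (λ i _ → rotate _ a (F i))) (sum-*ˡ n a _)
    where
    rotate : ∀ b a f → b * (a * f) ≈ a * (b * f)
    rotate = solve 3 (λ b a f → b :* (a :* f) := a :* (b :* f)) refl

  binom-0 : ∀ s n → binom s (λ _ → 0#) n ≈ 0#
  binom-0 s n = trans (sum-cong n (λ i _ → zeroʳ _)) (sum-0 n)

  binom-base : ∀ s (F : ℕ → Carrier) → binom s F 0 ≈ F 0
  binom-base s F = solve 1 (λ f → (con 1 :+ con 0) :* con 1 :* f := f) refl (F 0)

  binom-sum : ∀ s n p (G : ℕ → ℕ → Carrier) →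
              sumTo p (λ k → binom s (G k) n) ≈ binom s (λ i → sumTo p (λ k → G k i)) n
  binom-sum s n p G = trans (sum-swap p n _) (sum-cong n (λ i _ → sum-*ˡ p _ (λ k → G k i)))

  pascal-term : ∀ s (F : ℕ → Carrier) n i →
    fromℕ (suc n C suc i) * pow s (n ∸ i) * F (suc i)
      ≈ fromℕ (n C i) * pow s (n ∸ i) * F (suc i) + fromℕ (n C suc i) * pow s (n ∸ i) * F (suc i)
  pascal-term s F n i = begin
    fromℕ (suc n C suc i) * σ * f
      ≈⟨ *-congʳ (*-congʳ (sym (reflexive (cong fromℕ (nCk+nC[k+1]≡[n+1]C[k+1] n i))))) ⟩
    fromℕ (n C i +ℕ n C suc i) * σ * f
      ≈⟨ *-congʳ (*-congʳ (fromℕ-+ (n C i) (n C suc i))) ⟩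
    (fromℕ (n C i) + fromℕ (n C suc i)) * σ * f
      ≈⟨ solve 4 (λ a b σ f → (a :+ b) :* σ :* f := a :* σ :* f :+ b :* σ :* f) refl
                 (fromℕ (n C i)) (fromℕ (n C suc i)) σ f ⟩
    fromℕ (n C i) * σ * f + fromℕ (n C suc i) * σ * f ∎
    where
    σ f : Carrier
    σ = pow s (n ∸ i)
    f = F (suc i)

  upper-pascal-part : ∀ s (F : ℕ → Carrier) n →
    fromℕ 1 * pow s (suc n) * F 0 + sumTo n (λ i → fromℕ (n C suc i) * pow s (n ∸ i) * F (suc i))
      ≈ s * binom s F n
  upper-pascal-part s F n = begin
    Z 0 + sumTo n (λ i → Z (suc i))  ≈⟨ sym (sum-shift n Z) ⟩
    sumTo n Z + Z (suc n)            ≈⟨ +-congˡ top-vanishes ⟩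
    sumTo n Z + 0#                   ≈⟨ +-identityʳ _ ⟩
    sumTo n Z                        ≈⟨ sum-cong n (λ i i≤n → pull-s i i≤n) ⟩
    sumTo n (λ i → s * (fromℕ (n C i) * pow s (n ∸ i) * F i))  ≈⟨ sum-*ˡ n s _ ⟩
    s * binom s F n                  ∎
    where
    Z : ℕ → Carrier
    Z i = fromℕ (n C i) * pow s (suc n ∸ i) * F i
    top-vanishes : Z (suc n) ≈ 0#
    top-vanishes = begin
      fromℕ (n C suc n) * pow s (n ∸ n) * F (suc n)  ≈⟨ *-congʳ (*-congʳ (reflexive (cong fromℕ (k>n⇒nCk≡0 (n<1+n n))))) ⟩
      0# * pow s (n ∸ n) * F (suc n)                  ≈⟨ trans (*-congʳ (zeroˡ _)) (zeroˡ _) ⟩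
      0#                                              ∎
    pull-s : ∀ i → i ≤ n → Z i ≈ s * (fromℕ (n C i) * pow s (n ∸ i) * F i)
    pull-s i i≤n = begin
      fromℕ (n C i) * pow s (suc n ∸ i) * F i   ≡⟨ cong (λ e → fromℕ (n C i) * pow s e * F i) (+-∸-assoc 1 i≤n) ⟩
      fromℕ (n C i) * (s * pow s (n ∸ i)) * F i ≈⟨ solve 4 (λ a s σ f → a :* (s :* σ) :* f := s :* (a :* σ :* f)) refl _ s _ _ ⟩
      s * (fromℕ (n C i) * pow s (n ∸ i) * F i) ∎

  binom-step : ∀ s (F : ℕ → Carrier) n → binom s F (suc n) ≈ s * binom s F n + binom s (λ i → F (suc i)) n
  binom-step s F n = begin
    binom s F (suc n)
      ≈⟨ sum-shift n _ ⟩
    T₀ + sumTo n (λ i → fromℕ (suc n C suc i) * pow s (n ∸ i) * F (suc i))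
      ≈⟨ +-congˡ (trans (sum-cong n (λ i _ → pascal-term s F n i)) (sum-+ n _ _)) ⟩
    T₀ + (binom s (λ i → F (suc i)) n + U)
      ≈⟨ solve 3 (λ t b u → t :+ (b :+ u) := (t :+ u) :+ b) refl T₀ (binom s (λ i → F (suc i)) n) U ⟩
    (T₀ + U) + binom s (λ i → F (suc i)) n
      ≈⟨ +-congʳ (upper-pascal-part s F n) ⟩
    s * binom s F n + binom s (λ i → F (suc i)) n ∎
    where
    T₀ U : Carrier
    T₀ = fromℕ 1 * pow s (suc n) * F 0
    U  = sumTo n (λ i → fromℕ (n C suc i) * pow s (n ∸ i) * F (suc i))

  -- The contribution of column k-1 to column k in the recurrence:
  -- below q A 0 = 0 and below q A (k+1) = q^k A k.
  below : Carrier → (ℕ → Carrier) → ℕ → Carrier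
  below q A zero    = 0#
  below q A (suc k) = pow q k * A k

  below-cong : ∀ q {A B : ℕ → Carrier} → (∀ k → A k ≈ B k) → ∀ k → below q A k ≈ below q B k
  below-cong q A≈B zero    = refl
  below-cong q A≈B (suc k) = *-congˡ (A≈B k)

  binom-below : ∀ q s n (A : ℕ → ℕ → Carrier) k →
    binom s (λ i → below q (A i) k) n ≈ below q (λ j → binom s (λ i → A i j) n) k
  binom-below q s n A zero    = binom-0 s n
  binom-below q s n A (suc k) = binom-*ˡ s n (pow q k) (λ i → A i k)

  W-vanish : ∀ m q r n k → n < k → W m r q n k ≈ 0#
  W-vanish m q r zero    (suc k) _         = refl
  W-vanish m q r (suc n) (suc k) (s≤s n<k) = begin
    pow q k * W m r q n k + (m * qint q (suc k) + r) * W m r q n (suc k)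
      ≈⟨ +-cong (*-congˡ (W-vanish m q r n k n<k)) (*-congˡ (W-vanish m q r n (suc k) (m≤n⇒m≤1+n n<k))) ⟩
    pow q k * 0# + (m * qint q (suc k) + r) * 0#
      ≈⟨ solve 2 (λ a b → a :* con 0 :+ b :* con 0 := con 0) refl _ _ ⟩
    0# ∎

  module _ (m q : Carrier) where

    W-step : ∀ r n k → W m r q (suc n) k ≈ below q (W m r q n) k + (m * qint q k + r) * W m r q n k
    W-step r n zero    = sym (+-identityˡ _)
    W-step r n (suc k) = refl

    absorb-m : ∀ n k → W m 0# q n (suc k) ≈ pow m (n ∸ suc k) * Sq q n (suc k) →
               m * W m 0# q n (suc k) ≈ pow m (n ∸ k) * Sq q n (suc k)
    absorb-m n k scaled with k <? n
    ... | yes k<n = begin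
      m * W m 0# q n (suc k)                    ≈⟨ *-congˡ scaled ⟩
      m * (pow m (n ∸ suc k) * Sq q n (suc k))  ≈⟨ sym (*-assoc _ _ _) ⟩
      pow m (suc (n ∸ suc k)) * Sq q n (suc k)  ≡⟨ cong (λ e → pow m e * Sq q n (suc k)) (+-∸-assoc 1 k<n) ⟨
      pow m (n ∸ k) * Sq q n (suc k)            ∎
    ... | no k≮n = begin
      m * W m 0# q n (suc k)           ≈⟨ *-congˡ (W-vanish m q 0# n (suc k) n<k+1) ⟩
      m * 0#                           ≈⟨ zeroʳ m ⟩
      0#                               ≈⟨ sym (zeroʳ _) ⟩
      pow m (n ∸ k) * 0#               ≈⟨ *-congˡ (sym (W-vanish _ q 0# n (suc k) n<k+1)) ⟩
      pow m (n ∸ k) * Sq q n (suc k)   ∎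
      where
      n<k+1 : n < suc k
      n<k+1 = s≤s (≮⇒≥ k≮n)

    W-scaling : ∀ n k → W m 0# q n k ≈ pow m (n ∸ k) * Sq q n k
    W-scaling zero    zero    = sym (*-identityˡ 1#)
    W-scaling zero    (suc k) = sym (zeroʳ _)
    W-scaling (suc n) zero    =
      solve 4 (λ m p w s → (m :* con 0 :+ con 0) :* w := (m :* p) :* ((con 1 :* con 0 :+ con 0) :* s)) refl
        m (pow m n) (W m 0# q n 0) (Sq q n 0)
    W-scaling (suc n) (suc k) = begin
      pow q k * W m 0# q n k + (m * Q + 0#) * W m 0# q n (suc k)
        ≈⟨ +-congˡ (solve 3 (λ m Q w → (m :* Q :+ con 0) :* w := Q :* (m :* w)) refl m Q _) ⟩
      pow q k * W m 0# q n k + Q * (m * W m 0# q n (suc k))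
        ≈⟨ +-cong (*-congˡ (W-scaling n k)) (*-congˡ (absorb-m n k (W-scaling n (suc k)))) ⟩
      pow q k * (M * Sq q n k) + Q * (M * Sq q n (suc k))
        ≈⟨ solve 5 (λ p M s Q t → p :* (M :* s) :+ Q :* (M :* t) := M :* (p :* s :+ (con 1 :* Q :+ con 0) :* t))
                   refl (pow q k) M _ Q _ ⟩
      M * (pow q k * Sq q n k + (1# * Q + 0#) * Sq q n (suc k)) ∎
      where
      Q = qint q (suc k)
      M = pow m (n ∸ k)

    -- Column k of the binomial transform of W_{m,r,q} obeys the recurrence of W_{m,r+s,q}.
    binom-W-step : ∀ r s n k →
      binom s (λ i → W m r q i k) (suc n)
        ≈ below q (λ j → binom s (λ i → W m r q i j) n) k
          + (m * qint q k + (r + s)) * binom s (λ i → W m r q i k) n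
    binom-W-step r s n k = begin
      binom s col (suc n)
        ≈⟨ binom-step s col n ⟩
      s * binom s col n + binom s (λ i → W m r q (suc i) k) n
        ≈⟨ +-congˡ (binom-cong s n (λ i _ → W-step r i k)) ⟩
      s * binom s col n + binom s (λ i → below q (W m r q i) k + a * W m r q i k) n
        ≈⟨ +-congˡ (binom-+ s n _ _) ⟩
      s * binom s col n + (binom s (λ i → below q (W m r q i) k) n + binom s (λ i → a * col i) n)
        ≈⟨ +-congˡ (+-cong (binom-below q s n (W m r q) k) (binom-*ˡ s n a col)) ⟩
      s * B + (L + a * B)
        ≈⟨ solve 5 (λ s B L μ r → s :* B :+ (L :+ (μ :+ r) :* B) := L :+ (μ :+ (r :+ s)) :* B)
                   refl s B L (m * qint q k) r ⟩
      L + (m * qint q k + (r + s)) * B ∎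
      where
      col = λ i → W m r q i k
      a   = m * qint q k + r
      B   = binom s col n
      L   = below q (λ j → binom s (λ i → W m r q i j) n) k

    W-shift : ∀ {r s t} → t ≈ r + s → ∀ n k → W m t q n k ≈ binom s (λ i → W m r q i k) n
    W-shift {r} {s} {t} t≈r+s zero k = trans (base k) (sym (binom-base s (λ i → W m r q i k)))
      where
      base : ∀ k → W m t q 0 k ≈ W m r q 0 k
      base zero    = refl
      base (suc k) = refl
    W-shift {r} {s} {t} t≈r+s (suc n) k = begin
      W m t q (suc n) k
        ≈⟨ W-step t n k ⟩
      below q (W m t q n) k + (m * qint q k + t) * W m t q n k
        ≈⟨ +-cong (below-cong q (W-shift t≈r+s n) k) (*-cong (+-congˡ t≈r+s) (W-shift t≈r+s n k)) ⟩
      below q (λ j → binom s (λ i → W m r q i j) n) k + (m * qint q k + (r + s)) * binom s (λ i → W m r q i k) n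
        ≈⟨ sym (binom-W-step r s n k) ⟩
      binom s (λ i → W m r q i k) (suc n) ∎

    D-extend : ∀ r x {i n} → i ≤ n → sumTo n (λ k → W m r q i k * pow x k) ≈ D m r q i x
    D-extend r x {i} i≤n = sum-truncate _ (≤⇒≤′ i≤n)
      (λ k i<k → trans (*-congʳ (W-vanish m q r i k i<k)) (zeroˡ _))

    D-shift : ∀ {r s t} x → t ≈ r + s → ∀ n → D m t q n x ≈ binom s (λ i → D m r q i x) n
    D-shift {r} {s} x t≈r+s n = begin
      sumTo n (λ k → W m _ q n k * pow x k)
        ≈⟨ sum-cong n (λ k _ → *-congʳ (W-shift t≈r+s n k)) ⟩
      sumTo n (λ k → binom s (λ i → W m r q i k) n * pow x k)
        ≈⟨ sum-cong n (λ k _ → trans (*-comm _ _) (sym (binom-*ˡ s n (pow x k) (λ i → W m r q i k)))) ⟩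
      sumTo n (λ k → binom s (λ i → pow x k * W m r q i k) n)
        ≈⟨ binom-sum s n n (λ k i → pow x k * W m r q i k) ⟩
      binom s (λ i → sumTo n (λ k → pow x k * W m r q i k)) n
        ≈⟨ binom-cong s n (λ i i≤n → trans (sum-cong n (λ k _ → *-comm _ _)) (D-extend r x i≤n)) ⟩
      binom s (λ i → D m r q i x) n ∎

    D-scaling : ∀ x i → D m 0# q i x ≈ sumTo i (λ j → pow m (i ∸ j) * Sq q i j * pow x j)
    D-scaling x i = sum-cong i (λ j _ → *-congʳ (W-scaling i j))

theorem14 : ∀ {c ℓ : Level} (R : CommutativeRing c ℓ) →
    let open CommutativeRing R
        open QDefs R
    in (q m r x : Carrier) → ¬ (q ≈ 0#) → ¬ (q ≈ 1#) → (n : ℕ) →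
       D m r q n x ≈
         sumTo n (λ k → fromℕ (n C k) * pow r (n ∸ k)
           * sumTo k (λ j → pow m (k ∸ j) * Sq q k j * pow x j))
-- Apply (★) with r = 0 and s = r, then the scaling law to each D_{m,0,q}(i,x).
theorem14 R q m r x _ _ n = begin
  D m r q n x                            ≈⟨ D-shift m q x (sym (+-identityˡ r)) n ⟩
  binom r (λ i → D m 0# q i x) n         ≈⟨ binom-cong r n (λ i _ → D-scaling m q x i) ⟩
  binom r (λ i → sumTo i (λ j → pow m (i ∸ j) * Sq q i j * pow x j)) n ∎
  where
  open CommutativeRing R
  open QDefs R
  open Dowling R
  open import Relation.Binary.Reasoning.Setoid setoid
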